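{- If $G$ is a finite simple graph and $k$ is a positive integer, then $\mathrm{MOF}_k(G) \geq \alpha(G)$. Moreover, if $k \geq \Delta$, where $\Delta$ is the maximum degree of $G$, then $\mathrm{MOF}_k(G) = \alpha(G)$.
   Context: An orientation $D$ of a simple graph $G$ assigns to each edge exactly one direction; if $(u,v)$ is an arc, $v$ is an out-neighbor of $u$. Oriented $k$-forcing: starting from a nonempty set $S$ of colored vertices, repeatedly, any colored vertex having at most $k$ non-colored out-neighbors forces all of them to become colored (all forcings in a step simultaneous), until no change occurs; $S$ is a $k$-forcing set if all vertices end up colored. $F_k(D)$ is the minimum size of a $k$-forcing set of $D$. $\mathrm{MOF}_k(G)$ is the maximum of $F_k(D)$ over all orientations $D$ of $G$. $\alpha(G)$ is the independence number of $G$. -}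

module Defs where

open import Data.Nat using (ℕ; zero; suc; _≤ᵇ_; _⊔_; _⊓_)
open import Data.Bool using (Bool; true; false; _∧_; if_then_else_)
open import Data.Fin using (Fin)
open import Data.Fin.Subset using (Subset; _∈_; _∉_; ∁; _∩_; _∪_; ⋃; ∣_∣; ⊤; ⊥; Nonempty; inside; outside)
open import Data.Fin.Subset.Properties using (_∈?_; nonempty?)
open import Data.Fin.Properties using (all?)
open import Data.Vec using (Vec; []; _∷_; lookup; tabulate)
open import Data.Vec.Properties using (≡-dec)
open import Data.List using (List; []; _∷_; map; concatMap; filter; foldr; allFin)
open import Data.Product using (_×_; _,_)
open import Data.Sum using (_⊎_)
open import Relation.Nullary using (¬_; Dec; yes; no; does)
open import Relation.Nullary.Decidable using (_×-dec_; _⊎-dec_; ¬?; _→-dec_)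
open import Relation.Binary.PropositionalEquality using (_≡_)
import Data.Bool.Properties as BoolP

-- Graphs and digraphs on the vertex set Fin n, given by neighbourhoods.
-- G : Vec (Subset n) n,  lookup G u = (out-)neighbourhood of u.

Nbhd : ℕ → Set
Nbhd n = Vec (Subset n) n

Adj : ∀ {n} → Nbhd n → Fin n → Fin n → Set
Adj G u v = v ∈ lookup G u

IsSimpleGraph : ∀ {n} → Nbhd n → Set
IsSimpleGraph {n} G =
  (∀ (u : Fin n) → ¬ Adj G u u) × (∀ (u v : Fin n) → Adj G u v → Adj G v u)

IsOrientation : ∀ {n} → Nbhd n → Nbhd n → Set
IsOrientation {n} G D = ∀ (u v : Fin n) →
  (Adj D u v → Adj G u v) ×
  (Adj G u v → Adj D u v ⊎ Adj D v u) ×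
  ¬ (Adj D u v × Adj D v u)

isOrientation? : ∀ {n} (G D : Nbhd n) → Dec (IsOrientation G D)
isOrientation? G D = all? λ u → all? λ v →
  ((v ∈? lookup D u) →-dec (v ∈? lookup G u)) ×-dec
  (((v ∈? lookup G u) →-dec ((v ∈? lookup D u) ⊎-dec (u ∈? lookup D v))) ×-dec
  ¬? ((v ∈? lookup D u) ×-dec (u ∈? lookup D v)))

allSubsets : ∀ n → List (Subset n)
allSubsets zero    = [] ∷ []
allSubsets (suc n) = concatMap (λ s → (outside ∷ s) ∷ (inside ∷ s) ∷ []) (allSubsets n)

allVecs : ∀ {A : Set} → List A → ∀ m → List (Vec A m)
allVecs xs zero    = [] ∷ []
allVecs xs (suc m) = concatMap (λ v → map (λ x → x ∷ v) xs) (allVecs xs m)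

orientations : ∀ {n} → Nbhd n → List (Nbhd n)
orientations {n} G = filter (isOrientation? G) (allVecs (allSubsets n) n)

maxList : List ℕ → ℕ
maxList = foldr _⊔_ 0

-- minimum of a list; the empty list gets 0 (only happens for n = 0)
minList : List ℕ → ℕ
minList []       = 0
minList (x ∷ xs) = foldr _⊓_ x xs

uncoloredOut : ∀ {n} → Nbhd n → Subset n → Fin n → Subset n
uncoloredOut D C u = lookup D u ∩ ∁ C

forcedBy : ∀ {n} → Nbhd n → ℕ → Subset n → Fin n → Subset n
forcedBy D k C u =
  if does (u ∈? C) ∧ (∣ uncoloredOut D C u ∣ ≤ᵇ k)
  then uncoloredOut D C u else ⊥

step : ∀ {n} → Nbhd n → ℕ → Subset n → Subset n
step {n} D k C = C ∪ ⋃ (map (forcedBy D k C) (allFin n))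

iterate : ∀ {A : Set} → (A → A) → ℕ → A → A
iterate f zero    a = a
iterate f (suc m) a = iterate f m (f a)

-- final colored set: the process is monotone, so it is stable after
-- at most n steps; iterating n times reaches the terminal set.
closure : ∀ {n} → Nbhd n → ℕ → Subset n → Subset n
closure {n} D k S = iterate (step D k) n S

IsForcingSet : ∀ {n} → Nbhd n → ℕ → Subset n → Set
IsForcingSet D k S = Nonempty S × (closure D k S ≡ ⊤)

isForcingSet? : ∀ {n} (D : Nbhd n) k S → Dec (IsForcingSet D k S)
isForcingSet? D k S = nonempty? S ×-dec ≡-dec BoolP._≟_ (closure D k S) ⊤

F : ∀ {n} → ℕ → Nbhd n → ℕ
F {n} k D = minList (map ∣_∣ (filter (isForcingSet? D k) (allSubsets n)))

MOF : ∀ {n} → ℕ → Nbhd n → ℕ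
MOF k G = maxList (map (F k) (orientations G))

IsIndependent : ∀ {n} → Nbhd n → Subset n → Set
IsIndependent {n} G S = ∀ (u v : Fin n) → u ∈ S → v ∈ S → ¬ Adj G u v

isIndependent? : ∀ {n} (G : Nbhd n) S → Dec (IsIndependent G S)
isIndependent? G S = all? λ u → all? λ v →
  (u ∈? S) →-dec ((v ∈? S) →-dec ¬? (v ∈? lookup G u))

α : ∀ {n} → Nbhd n → ℕ
α {n} G = maxList (map ∣_∣ (filter (isIndependent? G) (allSubsets n)))

Δ : ∀ {n} → Nbhd n → ℕ
Δ {n} G = maxList (map (λ u → ∣ lookup G u ∣) (allFin n))

-- Lower bound: given an independent set I, orient every edge at a vertex of I
-- away from I (and the remaining edges by vertex index).  The vertices of I
-- are then sources, and a source can never be forced, so every forcing set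
-- contains I.
--
-- Upper bound: when k ≥ Δ every coloured vertex forces all its uncoloured
-- out-neighbours, so the final coloured set is the set of vertices reachable
-- from the initial one, and it suffices to find an independent set from which
-- every vertex is reachable.  If v is not reachable from the independent set I,
-- replace I by (I minus the out-neighbours of v) plus v: this set is still
-- independent (no arc enters v from I) and reaches strictly more vertices.
module Submission where

open import Data.Bool using (Bool; true; false; T; if_then_else_)
open import Data.Bool.Properties using (T-≡)
open import Data.Empty using (⊥-elim)
open import Data.Fin using (Fin; toℕ)
import Data.Fin as Fin
open import Data.Fin.Properties using (all?; ¬∀⟶∃¬; toℕ<n; toℕ-injective)
open import Data.Fin.Subset
open import Data.Fin.Subset.Properties
open import Data.List using (List; []; _∷_; map; filter; allFin)
open import Data.List.Membership.Propositional using (lose) renaming (_∈_ to _∈ₗ_)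
open import Data.List.Membership.Propositional.Properties
  using (∈-map⁺; ∈-map⁻; ∈-filter⁺; ∈-filter⁻; ∈-concatMap⁺; ∈-allFin)
open import Data.List.Properties using (foldr-preservesᵒ; foldr-preservesᵇ)
open import Data.List.Relation.Unary.All as All using (All; _∷_)
open import Data.List.Relation.Unary.All.Properties using () renaming (map⁺ to All-map⁺)
open import Data.List.Relation.Unary.Any as Any using (Any; here; there)
open import Data.Nat using (ℕ; zero; suc; _+_; _≤_; _<_; _≥_; _<ᵇ_; _≤ᵇ_; z≤n)
open import Data.Nat.Properties
open import Data.Product using (∃; _×_; _,_; proj₁; proj₂)
open import Data.Sum using (_⊎_; inj₁; inj₂; [_,_])
open import Data.Vec using (Vec; []; _∷_; lookup; tabulate)
open import Data.Vec.Properties using (lookup∘tabulate; []=⇒lookup; lookup⇒[]=)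
open import Function using (id; Equivalence)
open import Function.Definitions using (Injective)
open import Relation.Binary using (tri<; tri≈; tri>)
open import Relation.Binary.PropositionalEquality hiding ([_])
open import Relation.Nullary using (¬_; yes; no; does; contradiction)
open import Relation.Nullary.Decidable using (decidable-stable)
open import Relation.Unary using (Pred; Decidable)
open import Defs

maxList-≥ : ∀ {x xs} → x ∈ₗ xs → x ≤ maxList xs
maxList-≥ {x} {xs} x∈ =
  foldr-preservesᵒ {P = x ≤_} (λ m n → [ m≤n⇒m≤n⊔o n , m≤n⇒m≤o⊔n m ]) 0 xs (inj₂ (lose x∈ ≤-refl))

maxList-least : ∀ {b xs} → All (_≤ b) xs → maxList xs ≤ b
maxList-least = foldr-preservesᵇ ⊔-lub z≤n

minList-≤ : ∀ {x xs} → x ∈ₗ xs → minList xs ≤ x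
minList-≤ {x} {y ∷ ys} x∈ =
  foldr-preservesᵒ {P = _≤ x} (λ m n → [ m≤n⇒m⊓o≤n n , m≤n⇒o⊓m≤n m ]) y ys (headOrTail x∈)
  where
  headOrTail : x ∈ₗ y ∷ ys → y ≤ x ⊎ Any (_≤ x) ys
  headOrTail (here refl) = inj₁ ≤-refl
  headOrTail (there x∈ys) = inj₂ (lose x∈ys ≤-refl)

minList-greatest : ∀ {b x xs} → x ∈ₗ xs → All (b ≤_) xs → b ≤ minList xs
minList-greatest {xs = _ ∷ _} _ (b≤y ∷ b≤ys) = foldr-preservesᵇ ⊓-glb b≤y b≤ys

module _ {a p} {A : Set a} {P : Pred A p} (P? : Decidable P) (f : A → ℕ) {xs : List A} where

  maxList-map-filter-≥ : ∀ {x} → x ∈ₗ xs → P x → f x ≤ maxList (map f (filter P? xs))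
  maxList-map-filter-≥ x∈ px = maxList-≥ (∈-map⁺ f (∈-filter⁺ P? x∈ px))

  maxList-map-filter-least : ∀ {b} → (∀ {x} → x ∈ₗ xs → P x → f x ≤ b) →
                             maxList (map f (filter P? xs)) ≤ b
  maxList-map-filter-least bound = maxList-least (All-map⁺ (All.tabulate λ x∈ →
    let x∈xs , px = ∈-filter⁻ P? {xs = xs} x∈ in bound x∈xs px))

  minList-map-filter-≤ : ∀ {x} → x ∈ₗ xs → P x → minList (map f (filter P? xs)) ≤ f x
  minList-map-filter-≤ x∈ px = minList-≤ (∈-map⁺ f (∈-filter⁺ P? x∈ px))

  minList-map-filter-greatest : ∀ {b x} → x ∈ₗ xs → P x → (∀ {y} → y ∈ₗ xs → P y → b ≤ f y) →
                                b ≤ minList (map f (filter P? xs))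
  minList-map-filter-greatest x∈ px bound =
    minList-greatest (∈-map⁺ f (∈-filter⁺ P? x∈ px)) (All-map⁺ (All.tabulate λ y∈ →
      let y∈xs , py = ∈-filter⁻ P? {xs = xs} y∈ in bound y∈xs py))

∈-allSubsets : ∀ {n} (s : Subset n) → s ∈ₗ allSubsets n
∈-allSubsets [] = here refl
∈-allSubsets (b ∷ s) =
  ∈-concatMap⁺ (λ s → (outside ∷ s) ∷ (inside ∷ s) ∷ [])
    (Any.map (λ { refl → ∈-bothHeads b }) (∈-allSubsets s))
  where
  ∈-bothHeads : ∀ b → (b ∷ s) ∈ₗ (outside ∷ s) ∷ (inside ∷ s) ∷ []
  ∈-bothHeads false = here refl
  ∈-bothHeads true  = there (here refl)

∈-allVecs : ∀ {A : Set} {xs : List A} → (∀ a → a ∈ₗ xs) → ∀ {m} (v : Vec A m) → v ∈ₗ allVecs xs m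
∈-allVecs complete [] = here refl
∈-allVecs complete (a ∷ v) =
  ∈-concatMap⁺ (λ v → map (_∷ v) _)
    (Any.map (λ { refl → ∈-map⁺ (_∷ v) (complete a) }) (∈-allVecs complete v))

x∈⋃⁻ : ∀ {n} {x : Fin n} ps → x ∈ ⋃ ps → ∃ λ p → p ∈ₗ ps × x ∈ p
x∈⋃⁻ [] x∈ = contradiction x∈ ∉⊥
x∈⋃⁻ (p ∷ ps) x∈ with x∈p∪q⁻ p (⋃ ps) x∈
... | inj₁ x∈p = p , here refl , x∈p
... | inj₂ x∈⋃ps = let q , q∈ , x∈q = x∈⋃⁻ ps x∈⋃ps in q , there q∈ , x∈q

x∈⋃⁺ : ∀ {n} {x : Fin n} {p ps} → p ∈ₗ ps → x ∈ p → x ∈ ⋃ ps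
x∈⋃⁺ (here refl) x∈p = x∈p∪q⁺ (inj₁ x∈p)
x∈⋃⁺ (there p∈)  x∈p = x∈p∪q⁺ (inj₂ (x∈⋃⁺ p∈ x∈p))

x∈tabulate⁻ : ∀ {n} {f : Fin n → Bool} {x} → x ∈ tabulate f → T (f x)
x∈tabulate⁻ {f = f} {x} x∈ = Equivalence.from T-≡ (trans (sym (lookup∘tabulate f x)) ([]=⇒lookup x∈))

x∈tabulate⁺ : ∀ {n} {f : Fin n → Bool} {x} → T (f x) → x ∈ tabulate f
x∈tabulate⁺ {f = f} {x} t = lookup⇒[]= x _ (trans (lookup∘tabulate f x) (Equivalence.to T-≡ t))

p⊆q∧p⊄q⇒q≡p : ∀ {n} {p q : Subset n} → p ⊆ q → ¬ p ⊂ q → q ≡ p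
p⊆q∧p⊄q⇒q≡p {p = p} p⊆q p⊄q =
  ⊆-antisym (λ {x} x∈q → decidable-stable (x ∈? p) λ x∉p → p⊄q (p⊆q , x , x∈q , x∉p)) p⊆q

n≤∣p∣⇒p≡⊤ : ∀ {n} {p : Subset n} → n ≤ ∣ p ∣ → p ≡ ⊤
n≤∣p∣⇒p≡⊤ {p = p} n≤∣p∣ = ∣p∣≡n⇒p≡⊤ (≤-antisym (∣p∣≤n p) n≤∣p∣)

iterate-preserves : ∀ {A : Set} {p} (P : A → Set p) {f : A → A} →
                    (∀ {a} → P a → P (f a)) → ∀ m {a} → P a → P (iterate f m a)
iterate-preserves P pres zero    pa = pa
iterate-preserves P pres (suc m) pa = iterate-preserves P pres m (pres pa)

iterate-fixedPoint : ∀ {A : Set} {f : A → A} {a} → f a ≡ a → ∀ m → iterate f m a ≡ a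
iterate-fixedPoint fa≡a zero    = refl
iterate-fixedPoint {f = f} fa≡a (suc m) = trans (cong (iterate f m) fa≡a) (iterate-fixedPoint fa≡a m)

module _ {n} (f : Subset n → Subset n) (inflationary : ∀ {C} → C ⊆ f C) where

  iterate-stabilises-or-grows : ∀ m S →
    f (iterate f m S) ≡ iterate f m S ⊎ ∣ S ∣ + m ≤ ∣ iterate f m S ∣
  iterate-stabilises-or-grows zero S = inj₂ (≤-reflexive (+-identityʳ _))
  iterate-stabilises-or-grows (suc m) S with S ⊂? f S
  ... | no S⊄fS = inj₁ (trans (cong f stable) (trans fS≡S (sym stable)))
    where
    fS≡S : f S ≡ S
    fS≡S = p⊆q∧p⊄q⇒q≡p inflationary S⊄fS
    stable : iterate f (suc m) S ≡ S
    stable = iterate-fixedPoint fS≡S (suc m)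
  ... | yes S⊂fS with iterate-stabilises-or-grows m (f S)
  ...   | inj₁ stable = inj₁ stable
  ...   | inj₂ grown  = inj₂ (begin
    ∣ S ∣ + suc m  ≡⟨ +-suc ∣ S ∣ m ⟩
    suc ∣ S ∣ + m  ≤⟨ +-monoˡ-≤ m (p⊂q⇒∣p∣<∣q∣ S⊂fS) ⟩
    ∣ f S ∣ + m    ≤⟨ grown ⟩
    ∣ iterate f m (f S) ∣ ∎)
    where open ≤-Reasoning

  iterate-stabilises : ∀ S → f (iterate f n S) ≡ iterate f n S
  iterate-stabilises S with iterate-stabilises-or-grows n S
  ... | inj₁ stable = stable
  ... | inj₂ grown = subst (λ C → f C ≡ C) (sym (n≤∣p∣⇒p≡⊤ (≤-trans (m≤n+m n ∣ S ∣) grown)))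
                             (⊆-antisym ⊆⊤ inflationary)

OutClosed : ∀ {n} → Nbhd n → Subset n → Set
OutClosed D C = ∀ {u v} → u ∈ C → Adj D u v → v ∈ C

IsSource : ∀ {n} → Nbhd n → Fin n → Set
IsSource {n} D v = ∀ (u : Fin n) → ¬ Adj D u v

OutDegree≤ : ∀ {n} → Nbhd n → ℕ → Set
OutDegree≤ {n} D k = ∀ (u : Fin n) → ∣ lookup D u ∣ ≤ k

module _ {n} (D : Nbhd n) (k : ℕ) where

  forcedBy⁻ : ∀ {C u v} → v ∈ forcedBy D k C u → u ∈ C × Adj D u v
  forcedBy⁻ {C} {u} v∈ with u ∈? C | ∣ uncoloredOut D C u ∣ ≤ᵇ k
  ... | yes u∈C | true  = u∈C , proj₁ (x∈p∩q⁻ _ _ v∈)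
  ... | yes _   | false = contradiction v∈ ∉⊥
  ... | no _    | _     = contradiction v∈ ∉⊥

  forcedBy⁺ : ∀ {C u v} → u ∈ C → ∣ uncoloredOut D C u ∣ ≤ k → v ∈ uncoloredOut D C u →
              v ∈ forcedBy D k C u
  forcedBy⁺ {C} {u} u∈C few v∈ with u ∈? C | ∣ uncoloredOut D C u ∣ ≤ᵇ k | ≤⇒≤ᵇ few
  ... | yes _   | true  | _  = v∈
  ... | yes _   | false | ()
  ... | no u∉C  | _     | _  = contradiction u∈C u∉C

  C⊆step : ∀ {C} → C ⊆ step D k C
  C⊆step x∈C = x∈p∪q⁺ (inj₁ x∈C)

  step⁻ : ∀ {C v} → v ∈ step D k C → v ∈ C ⊎ ∃ λ u → u ∈ C × Adj D u v
  step⁻ {C} v∈ with x∈p∪q⁻ C _ v∈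
  ... | inj₁ v∈C = inj₁ v∈C
  ... | inj₂ v∈⋃ with x∈⋃⁻ (map (forcedBy D k C) (allFin n)) v∈⋃
  ...   | _ , p∈ , v∈p with ∈-map⁻ (forcedBy D k C) p∈
  ...     | u , _ , refl = inj₂ (u , forcedBy⁻ v∈p)

  ⊆-closure : ∀ {S} → S ⊆ closure D k S
  ⊆-closure {S} = iterate-preserves (S ⊆_) (λ S⊆C x∈S → C⊆step (S⊆C x∈S)) n id

  closure-least : ∀ {S C} → OutClosed D C → S ⊆ C → closure D k S ⊆ C
  closure-least {C = C} closed = iterate-preserves (_⊆ C) preserve n
    where
    preserve : ∀ {B} → B ⊆ C → step D k B ⊆ C
    preserve B⊆C v∈ with step⁻ v∈
    ... | inj₁ v∈B = B⊆C v∈B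
    ... | inj₂ (u , u∈B , uv) = closed (B⊆C u∈B) uv

  source∈closure⇒∈ : ∀ {S v} → IsSource D v → v ∈ closure D k S → v ∈ S
  source∈closure⇒∈ {S} {v} source = iterate-preserves (λ C → v ∈ C → v ∈ S) preserve n id
    where
    preserve : ∀ {C} → (v ∈ C → v ∈ S) → v ∈ step D k C → v ∈ S
    preserve back v∈ with step⁻ v∈
    ... | inj₁ v∈C = back v∈C
    ... | inj₂ (u , _ , uv) = ⊥-elim (source u uv)

  source∈forcingSet : ∀ {S v} → IsForcingSet D k S → IsSource D v → v ∈ S
  source∈forcingSet (_ , closure≡⊤) source =
    source∈closure⇒∈ source (subst (_ ∈_) (sym closure≡⊤) ∈⊤)

  ⊤-isForcingSet : Fin n → IsForcingSet D k ⊤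
  ⊤-isForcingSet v = (v , ∈⊤) , ⊆-antisym ⊆⊤ ⊆-closure

  module _ (deg : OutDegree≤ D k) where

    step-out : ∀ {C u v} → u ∈ C → Adj D u v → v ∈ step D k C
    step-out {C} {u} {v} u∈C uv with v ∈? C
    ... | yes v∈C = C⊆step v∈C
    ... | no v∉C  = x∈p∪q⁺ (inj₂ (x∈⋃⁺ (∈-map⁺ (forcedBy D k C) (∈-allFin u))
                      (forcedBy⁺ u∈C few (x∈p∩q⁺ (uv , x∉p⇒x∈∁p v∉C)))))
      where
      few : ∣ uncoloredOut D C u ∣ ≤ k
      few = ≤-trans (∣p∩q∣≤∣p∣ (lookup D u) (∁ C)) (deg u)

    closure-outClosed : ∀ S → OutClosed D (closure D k S)
    closure-outClosed S u∈ uv = subst (_ ∈_) (iterate-stabilises (step D k) C⊆step S) (step-out u∈ uv)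

module _ {n} {G D : Nbhd n} (simple : IsSimpleGraph G) (orientation : IsOrientation G D) where

  extend : Subset n → Fin n → Subset n
  extend I v = (I ∩ ∁ (lookup D v)) ∪ ⁅ v ⁆

  v∈extend : ∀ {I v} → v ∈ extend I v
  v∈extend {v = v} = x∈p∪q⁺ (inj₂ (x∈⁅x⁆ v))

  ∈-extend⁺ : ∀ {I v x} → x ∈ I → ¬ Adj D v x → x ∈ extend I v
  ∈-extend⁺ x∈I ¬vx = x∈p∪q⁺ (inj₁ (x∈p∩q⁺ (x∈I , x∉p⇒x∈∁p ¬vx)))

  ∈-extend⁻ : ∀ {I v x} → x ∈ extend I v → (x ∈ I × ¬ Adj D v x) ⊎ x ≡ v
  ∈-extend⁻ {v = v} x∈ with x∈p∪q⁻ _ _ x∈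
  ... | inj₁ x∈I∖Dv = let x∈I , x∈∁Dv = x∈p∩q⁻ _ _ x∈I∖Dv in inj₁ (x∈I , x∈∁p⇒x∉p x∈∁Dv)
  ... | inj₂ x∈⁅v⁆ = inj₂ (x∈⁅y⁆⇒x≡y v x∈⁅v⁆)

  nonAdjacent-extend : ∀ {I v x} → (∀ {u} → u ∈ I → ¬ Adj D u v) → x ∈ I → ¬ Adj D v x →
                       ¬ Adj G v x
  nonAdjacent-extend {v = v} {x} noArcIn x∈I ¬vx vx with proj₁ (proj₂ (orientation v x)) vx
  ... | inj₁ arc-vx = ¬vx arc-vx
  ... | inj₂ arc-xv = noArcIn x∈I arc-xv

  extend-independent : ∀ {I v} → IsIndependent G I → (∀ {u} → u ∈ I → ¬ Adj D u v) →
                       IsIndependent G (extend I v)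
  extend-independent {I} {v} independent noArcIn a b a∈ b∈ ab with ∈-extend⁻ a∈ | ∈-extend⁻ b∈
  ... | inj₁ (a∈I , _)   | inj₁ (b∈I , _)   = independent a b a∈I b∈I ab
  ... | inj₂ refl        | inj₁ (b∈I , ¬vb) = nonAdjacent-extend noArcIn b∈I ¬vb ab
  ... | inj₁ (a∈I , ¬va) | inj₂ refl        = nonAdjacent-extend noArcIn a∈I ¬va (proj₂ simple a v ab)
  ... | inj₂ refl        | inj₂ refl        = proj₁ simple v ab

  module _ {k} (deg : OutDegree≤ D k) where

    unreachable⇒noArcIn : ∀ {I u v} → v ∉ closure D k I → u ∈ I → ¬ Adj D u v
    unreachable⇒noArcIn v∉ u∈I uv = v∉ (closure-outClosed D k deg _ (⊆-closure D k u∈I) uv)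

    closure⊂closure-extend : ∀ {I v} → v ∉ closure D k I → closure D k I ⊂ closure D k (extend I v)
    closure⊂closure-extend {I} {v} v∉ =
      closure-least D k (closure-outClosed D k deg _) I⊆ , v , ⊆-closure D k v∈extend , v∉
      where
      I⊆ : I ⊆ closure D k (extend I v)
      I⊆ {x} x∈I with x ∈? lookup D v
      ... | yes vx  = closure-outClosed D k deg _ (⊆-closure D k v∈extend) vx
      ... | no ¬vx  = ⊆-closure D k (∈-extend⁺ x∈I ¬vx)

    extendToForcing : ∀ fuel {I} → Nonempty I → IsIndependent G I →
                      n ≤ fuel + ∣ closure D k I ∣ →
                      ∃ λ J → IsIndependent G J × IsForcingSet D k J
    extendToForcing fuel {I} nonempty independent bound with all? (_∈? closure D k I)
    ... | yes all∈ = I , independent , nonempty , ⊆-antisym ⊆⊤ (λ {x} _ → all∈ x)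
    ... | no ¬all∈ with ¬∀⟶∃¬ n _ (_∈? closure D k I) ¬all∈ | fuel
    ...   | v , v∉ | zero = contradiction (subst (v ∈_) (sym (n≤∣p∣⇒p≡⊤ bound)) ∈⊤) v∉
    ...   | v , v∉ | suc fuel =
      extendToForcing fuel (v , v∈extend) (extend-independent independent (unreachable⇒noArcIn v∉))
        (begin
          n                                    ≤⟨ bound ⟩
          suc fuel + ∣ closure D k I ∣          ≡⟨ +-suc fuel _ ⟨
          fuel + suc ∣ closure D k I ∣          ≤⟨ +-monoʳ-≤ fuel (p⊂q⇒∣p∣<∣q∣ (closure⊂closure-extend v∉)) ⟩
          fuel + ∣ closure D k (extend I v) ∣  ∎)
      where open ≤-Reasoning

    independentForcingSet : Fin n → ∃ λ J → IsIndependent G J × IsForcingSet D k J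
    independentForcingSet v = extendToForcing n (v , x∈⁅x⁆ v) singleton-independent (m≤m+n n _)
      where
      singleton-independent : IsIndependent G ⁅ v ⁆
      singleton-independent a b a∈ b∈ rewrite x∈⁅y⁆⇒x≡y v a∈ | x∈⁅y⁆⇒x≡y v b∈ = proj₁ simple v

rankOrientation : ∀ {n} → (Fin n → ℕ) → Nbhd n → Nbhd n
rankOrientation r G = tabulate λ u → lookup G u ∩ tabulate λ v → r u <ᵇ r v

module _ {n} (r : Fin n → ℕ) (G : Nbhd n) where

  rankOrientation⁻ : ∀ {u v} → Adj (rankOrientation r G) u v → Adj G u v × r u < r v
  rankOrientation⁻ {u} {v} uv with x∈p∩q⁻ _ _ (subst (v ∈_) (lookup∘tabulate _ u) uv)
  ... | Guv , ranked = Guv , <ᵇ⇒< (r u) (r v) (x∈tabulate⁻ ranked)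

  rankOrientation⁺ : ∀ {u v} → Adj G u v → r u < r v → Adj (rankOrientation r G) u v
  rankOrientation⁺ {u} {v} Guv lt =
    subst (v ∈_) (sym (lookup∘tabulate _ u)) (x∈p∩q⁺ (Guv , x∈tabulate⁺ (<⇒<ᵇ lt)))

  rankOrientation-isOrientation : IsSimpleGraph G → Injective _≡_ _≡_ r →
                                  IsOrientation G (rankOrientation r G)
  rankOrientation-isOrientation (irreflexive , symmetric) r-injective u v =
    (λ uv → proj₁ (rankOrientation⁻ uv)) , cover ,
    λ (uv , vu) → <-asym (proj₂ (rankOrientation⁻ uv)) (proj₂ (rankOrientation⁻ vu))
    where
    cover : Adj G u v → Adj (rankOrientation r G) u v ⊎ Adj (rankOrientation r G) v u
    cover Guv with <-cmp (r u) (r v)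
    ... | tri< lt _ _ = inj₁ (rankOrientation⁺ Guv lt)
    ... | tri≈ _ eq _ = ⊥-elim (irreflexive u (subst (Adj G u) (sym (r-injective eq)) Guv))
    ... | tri> _ _ gt = inj₂ (rankOrientation⁺ (symmetric u v Guv) gt)

module _ {n} (I : Subset n) where

  membersFirst : Fin n → ℕ
  membersFirst u = if does (u ∈? I) then toℕ u else n + toℕ u

  private
    toℕ<n+ : ∀ (u : Fin n) m → toℕ u < n + m
    toℕ<n+ u m = ≤-trans (toℕ<n u) (m≤m+n n m)

  membersFirst-< : ∀ {u v} → u ∈ I → v ∉ I → membersFirst u < membersFirst v
  membersFirst-< {u} {v} u∈ v∉ with u ∈? I | v ∈? I
  ... | yes _  | no _   = toℕ<n+ u (toℕ v)
  ... | yes _  | yes v∈ = contradiction v∈ v∉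
  ... | no u∉  | _      = contradiction u∈ u∉

  membersFirst-injective : Injective _≡_ _≡_ membersFirst
  membersFirst-injective {u} {v} eq with u ∈? I | v ∈? I
  ... | yes _ | yes _ = toℕ-injective eq
  ... | yes _ | no _  = contradiction eq (<⇒≢ (toℕ<n+ u (toℕ v)))
  ... | no _  | yes _ = contradiction (sym eq) (<⇒≢ (toℕ<n+ v (toℕ u)))
  ... | no _  | no _  = toℕ-injective (+-cancelˡ-≡ n _ _ eq)

  membersFirst-sources : ∀ {G} → IsIndependent G I → ∀ {v} → v ∈ I →
                         IsSource (rankOrientation membersFirst G) v
  membersFirst-sources {G} independent {v} v∈ u uv =
    let Guv , lt = rankOrientation⁻ membersFirst G uv
    in <-asym lt (membersFirst-< v∈ λ u∈ → independent u v u∈ v∈ Guv)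

module _ {n} (G : Nbhd n) where

  ∣I∣≤α : ∀ {I} → IsIndependent G I → ∣ I ∣ ≤ α G
  ∣I∣≤α {I} = maxList-map-filter-≥ (isIndependent? G) ∣_∣ (∈-allSubsets I)

  α-least : ∀ {b} → (∀ {I} → IsIndependent G I → ∣ I ∣ ≤ b) → α G ≤ b
  α-least bound = maxList-map-filter-least (isIndependent? G) ∣_∣ {allSubsets n} λ _ → bound

  F≤MOF : ∀ {k D} → IsOrientation G D → F k D ≤ MOF k G
  F≤MOF {k} {D} = maxList-map-filter-≥ (isOrientation? G) (F k) (∈-allVecs ∈-allSubsets D)

  MOF-least : ∀ {k b} → (∀ {D} → IsOrientation G D → F k D ≤ b) → MOF k G ≤ b
  MOF-least {k} bound =
    maxList-map-filter-least (isOrientation? G) (F k) {allVecs (allSubsets n) n} λ {D} _ → bound {D}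

  degree≤Δ : ∀ u → ∣ lookup G u ∣ ≤ Δ G
  degree≤Δ u = maxList-≥ (∈-map⁺ (λ u → ∣ lookup G u ∣) (∈-allFin u))

  orientation-outDegree≤ : ∀ {D k} → IsOrientation G D → Δ G ≤ k → OutDegree≤ D k
  orientation-outDegree≤ orientation Δ≤k u =
    ≤-trans (p⊆q⇒∣p∣≤∣q∣ (proj₁ (orientation u _))) (≤-trans (degree≤Δ u) Δ≤k)

module _ {n} (D : Nbhd n) (k : ℕ) where

  F≤∣S∣ : ∀ {S} → IsForcingSet D k S → F k D ≤ ∣ S ∣
  F≤∣S∣ {S} = minList-map-filter-≤ (isForcingSet? D k) ∣_∣ (∈-allSubsets S)

  ∣sources∣≤F : ∀ {I} → (∀ {v} → v ∈ I → IsSource D v) → ∣ I ∣ ≤ F k D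
  ∣sources∣≤F {I} sources with nonempty? I
  ... | no empty = ≤-trans (≤-reflexive (trans (cong ∣_∣ (Empty-unique empty)) (∣⊥∣≡0 n))) z≤n
  ... | yes (v , _) =
    minList-map-filter-greatest (isForcingSet? D k) ∣_∣ (∈-allSubsets ⊤) (⊤-isForcingSet D k v)
      λ _ forcing → p⊆q⇒∣p∣≤∣q∣ λ x∈I → source∈forcingSet D k forcing (sources x∈I)

F≤α : ∀ {n} (G D : Nbhd n) {k} → IsSimpleGraph G → IsOrientation G D → OutDegree≤ D k →
      F k D ≤ α G
F≤α {zero}  [] [] _ _ _ = z≤n
F≤α {suc _} G D simple orientation deg =
  let _ , independent , forcing = independentForcingSet {G = G} {D} simple orientation deg Fin.zero
  in ≤-trans (F≤∣S∣ D _ forcing) (∣I∣≤α G independent)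

∣I∣≤MOF : ∀ {n} (G : Nbhd n) {I} k → IsSimpleGraph G → IsIndependent G I → ∣ I ∣ ≤ MOF k G
∣I∣≤MOF G {I} k simple independent =
  ≤-trans (∣sources∣≤F D k (membersFirst-sources I {G} independent))
          (F≤MOF G {k} {D} orientation)
  where
  D : Nbhd _
  D = rankOrientation (membersFirst I) G
  orientation : IsOrientation G D
  orientation = rankOrientation-isOrientation (membersFirst I) G simple (membersFirst-injective I)

MOF≤α : ∀ {n} (G : Nbhd n) {k} → IsSimpleGraph G → Δ G ≤ k → MOF k G ≤ α G
MOF≤α G simple Δ≤k = MOF-least G λ {D} orientation →
  F≤α G D simple orientation (orientation-outDegree≤ G {D} orientation Δ≤k)

theorem3p15 : ∀ (n : ℕ) (G : Nbhd n) → IsSimpleGraph G → (k : ℕ) → 1 ≤ k →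
    (MOF k G ≥ α G) × (k ≥ Δ G → MOF k G ≡ α G)
theorem3p15 n G simple k _ = α≤MOF , λ Δ≤k → ≤-antisym (MOF≤α G simple Δ≤k) α≤MOF
  where
  α≤MOF : α G ≤ MOF k G
  α≤MOF = α-least G (∣I∣≤MOF G k simple)
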